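{- Let $n\ge 2$ and let $\mathbf u$ be a transpositional sequence in $\mathrm{Sym}(n)$ whose transpositional multigraph $\mathcal T(\mathbf u)$ is a multitree on vertex set $n$ with no multiedge of even multiplicity, and none of whose vertices lies on more than one non-simple multiedge. Then every element of $\mathrm{Prod}(\mathbf u)$ is an $n$-cycle, i.e. $\mathrm{Prod}(\mathbf u)\subseteq n^1$.
   Context: $n=\{0,\ldots,n-1\}$; permutations compose left to right. For a finite sequence $\mathbf s$ in $\mathrm{Sym}(n)$, $\bigcirc\mathbf s$ is the composite of its terms in order, $\mathrm{Seq}(\mathbf s)$ the set of rearrangements and $\mathrm{Prod}(\mathbf s)=\{\bigcirc\mathbf r:\mathbf r\in\mathrm{Seq}(\mathbf s)\}$. $n^1$ denotes the set of $n$-cycles in $\mathrm{Sym}(n)$. For a sequence $\mathbf u$ of transpositions, $\mathcal T(\mathbf u)$ is the multigraph on vertex set $n$ in which the multiedge $(x\,y)$ has multiplicity equal to the number of terms of $\mathbf u$ equal to $(x\,y)$. A multiedge is non-simple if its multiplicity is at least $2$. A multitree is a multigraph whose underlying simple graph (ignoring multiplicities) is a tree. -}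

module Defs where

open import Data.Nat using (ℕ; zero; suc; _<_; _≤_)
open import Data.Fin using (Fin; _≟_)
open import Data.Fin.Permutation using (Permutation′; transpose; id; _∘ₚ_; _⟨$⟩ʳ_)
open import Data.Product using (_×_; _,_; ∃-syntax; Σ-syntax)
open import Data.List using (List; []; _∷_; length)
open import Data.List.Relation.Unary.All using (All)
open import Data.List.Relation.Unary.Unique.Propositional using (Unique)
open import Data.Sum using (_⊎_)
open import Relation.Nullary using (¬_; yes; no)
open import Relation.Binary.PropositionalEquality using (_≡_; _≢_)
open import Relation.Binary.Construct.Closure.ReflexiveTransitive using (Star)

-- A term of a transpositional sequence: the pair (a , b) stands for the
-- transposition (a b); a sequence is transpositional when a ≢ b for every term.
Term : ℕ → Set
Term n = Fin n × Fin n

IsTranspositional : ∀ {n} → List (Term n) → Set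
IsTranspositional u = All (λ { (a , b) → a ≢ b }) u

toPerm : ∀ {n} → Term n → Permutation′ n
toPerm (a , b) = transpose a b

-- ○ s : composite of the terms in order, composing left to right
-- (π ∘ₚ ρ applies π first, then ρ).
○ : ∀ {n} → List (Term n) → Permutation′ n
○ []      = id
○ (t ∷ s) = toPerm t ∘ₚ ○ s

iter : ∀ {A : Set} → ℕ → (A → A) → A → A
iter zero    f x = x
iter (suc k) f x = f (iter k f x)

-- σ is an n-cycle: ⟨σ⟩ acts transitively on n (a single orbit of size n).
IsNCycle : ∀ {n} → Permutation′ n → Set
IsNCycle {n} σ = ∀ (x y : Fin n) → ∃[ k ] iter k (σ ⟨$⟩ʳ_) x ≡ y

-- multiplicity of the multiedge (x y) in 𝒯(u): number of terms equal to (x y)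
mult : ∀ {n} → List (Term n) → Fin n → Fin n → ℕ
mult []            x y = 0
mult ((a , b) ∷ u) x y with a ≟ x | b ≟ y | a ≟ y | b ≟ x
... | yes _ | yes _ | _     | _     = suc (mult u x y)
... | _     | _     | yes _ | yes _ = suc (mult u x y)
... | _     | _     | _     | _     = mult u x y

Adj : ∀ {n} → List (Term n) → Fin n → Fin n → Set
Adj u x y = x ≢ y × 0 < mult u x y

Connected : ∀ {n} → List (Term n) → Set
Connected {n} u = ∀ (x y : Fin n) → Star (Adj u) x y

-- a cycle in the underlying simple graph: distinct vertices v₀ … v_k with k ≥ 2,
-- consecutive vertices adjacent and v_k adjacent to v₀
data Walk {n} (u : List (Term n)) : List (Fin n) → Set where
  single : ∀ v → Walk u (v ∷ [])
  step   : ∀ v w vs → Adj u v w → Walk u (w ∷ vs) → Walk u (v ∷ w ∷ vs)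

last : ∀ {n} → Fin n → List (Fin n) → Fin n
last v []       = v
last v (w ∷ ws) = last w ws

HasCycle : ∀ {n} → List (Term n) → Set
HasCycle {n} u = Σ[ v ∈ Fin n ] Σ[ vs ∈ List (Fin n) ]
  (Walk u (v ∷ vs) × Unique (v ∷ vs) × 2 ≤ length vs × Adj u (last v vs) v)

IsMultitree : ∀ {n} → List (Term n) → Set
IsMultitree u = Connected u × ¬ HasCycle u

module Submission where

-- Write  apply r  for the left-to-right composite of the transpositions of r
-- acting on points, so that  ○ r ⟨$⟩ʳ z ≡ apply r z.  As 𝒯(u) is connected and
-- every rearrangement r of u has the same multigraph, it suffices to prove
--   (★)  the two ends of every edge of 𝒯(r) lie in one orbit of apply r
-- for every "admissible" r: transpositional, acyclic, with odd multiplicities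
-- and with the non-simple multiedges forming a matching.  (★) is proved by
-- induction on the length of r.
--   * If no multiedge is simple, every edge {p,q} is isolated: each term that
--     touches p or q is (p q), so apply r swaps p and q (odd multiplicity).
--   * Otherwise r = xs ++ t ∷ ys with t = (a b) a simple edge.  Property (★)
--     is invariant under rotating the sequence (rotations are conjugate), so
--     it suffices to treat t ∷ s with s = ys ++ xs.  Since 𝒯(t ∷ s) is acyclic,
--     a and b lie in different orbits of apply s, so composing with (a b)
--     merges these two orbits and keeps every other orbit of apply s together;
--     (★) for s holds by induction.

open import Defs
import Data.Nat as ℕ
open import Data.Nat using (ℕ; zero; suc; pred; _+_; _*_; _≤_; _<_; _%_; z≤n; s≤s)
open import Data.Nat.Properties
  using (+-comm; +-suc; *-suc; <-irrefl; ≤-refl; ≤-trans; ≤-reflexive; ≤-pred; <-≤-trans;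
         m≤n+m; m≤m+n; n<1+n; m≤n⇒∃[o]m+o≡n)
open import Data.Nat.ListAction using (sum)
open import Data.Nat.ListAction.Properties using (sum-++; sum-↭)
open import Data.Fin using (Fin; _≟_; toℕ)
open import Data.Fin.Properties using (pigeonhole)
import Data.Fin.Permutation.Components as PC
open import Data.Fin.Permutation using (_⟨$⟩ʳ_)
open import Data.Product using (_×_; _,_; ∃-syntax; Σ-syntax; proj₁; proj₂)
open import Data.Sum using (_⊎_; inj₁; inj₂)
open import Data.List using (List; []; _∷_; _++_; length; map)
open import Data.List.Properties using (map-++; map-cong)
open import Data.List.Membership.Propositional using (_∈_; find)
open import Data.List.Membership.Propositional.Properties using (∈-∃++)
import Data.List.Membership.DecPropositional as DecMembership
open import Data.List.Relation.Unary.Any using (here; there; any?)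
open import Data.List.Relation.Unary.All using (All; []; _∷_; tail; tabulate; lookup)
open import Data.List.Relation.Unary.All.Properties using (¬Any⇒All¬; ++⁻ˡ)
open import Data.List.Relation.Unary.AllPairs using ([]; _∷_)
open import Data.List.Relation.Unary.Unique.Propositional using (Unique)
open import Data.List.Relation.Binary.Permutation.Propositional using (_↭_; ↭-sym)
open import Data.List.Relation.Binary.Permutation.Propositional.Properties
  using (All-resp-↭; map⁺; ++-comm; ↭-length)
open import Relation.Binary.Construct.Closure.ReflexiveTransitive using (Star; ε; _◅_; _◅◅_)
import Relation.Binary.Construct.Closure.ReflexiveTransitive as Star
open import Relation.Nullary using (¬_; yes; no; Dec)
open import Relation.Binary.PropositionalEquality
open import Function.Definitions using (Injective)
open import Data.Empty using (⊥-elim)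

module _ {n : ℕ} where

  swap : Term n → Fin n → Fin n
  swap (a , b) = PC.transpose a b

  apply : List (Term n) → Fin n → Fin n
  apply []      z = z
  apply (t ∷ r) z = apply r (swap t z)

  ○-apply : ∀ r z → ○ r ⟨$⟩ʳ z ≡ apply r z
  ○-apply []      z = refl
  ○-apply (t ∷ r) z = ○-apply r (swap t z)

  apply-++ : ∀ xs ys z → apply (xs ++ ys) z ≡ apply ys (apply xs z)
  apply-++ []       ys z = refl
  apply-++ (t ∷ xs) ys z = apply-++ xs ys (swap t z)

  apply-rotate : ∀ xs ys z → apply (ys ++ xs) (apply xs z) ≡ apply xs (apply (xs ++ ys) z)
  apply-rotate xs ys z = begin
    apply (ys ++ xs) (apply xs z)    ≡⟨ apply-++ ys xs (apply xs z) ⟩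
    apply xs (apply ys (apply xs z)) ≡⟨ cong (apply xs) (apply-++ xs ys z) ⟨
    apply xs (apply (xs ++ ys) z) ∎
    where open ≡-Reasoning

  swap-left : ∀ a b → swap (a , b) a ≡ b
  swap-left a b with a ≟ a
  ... | yes _  = refl
  ... | no a≢a = ⊥-elim (a≢a refl)

  swap-right : ∀ a b → swap (a , b) b ≡ a
  swap-right a b with b ≟ a
  ... | yes b≡a = b≡a
  ... | no _ with b ≟ b
  ...   | yes _  = refl
  ...   | no b≢b = ⊥-elim (b≢b refl)

  swap-fixes : ∀ a b z → z ≢ a → z ≢ b → swap (a , b) z ≡ z
  swap-fixes a b z z≢a z≢b with z ≟ a
  ... | yes z≡a = ⊥-elim (z≢a z≡a)
  ... | no _ with z ≟ b
  ...   | yes z≡b = ⊥-elim (z≢b z≡b)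
  ...   | no _    = refl

  swap-involutive : ∀ t z → swap t (swap t z) ≡ z
  swap-involutive (a , b) z = by-cases (z ≟ a) (z ≟ b)
    where
    τ = swap (a , b)
    by-cases : Dec (z ≡ a) → Dec (z ≡ b) → τ (τ z) ≡ z
    by-cases (yes refl) _          = trans (cong τ (swap-left z b)) (swap-right z b)
    by-cases (no _)     (yes refl) = trans (cong τ (swap-right a z)) (swap-left a z)
    by-cases (no z≢a)   (no z≢b)   = trans (cong τ (swap-fixes a b z z≢a z≢b)) (swap-fixes a b z z≢a z≢b)

  swap-injective : ∀ t → Injective _≡_ _≡_ (swap t)
  swap-injective t {x} {y} e =
    trans (sym (swap-involutive t x)) (trans (cong (swap t) e) (swap-involutive t y))

  apply-injective : ∀ r → Injective _≡_ _≡_ (apply r)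
  apply-injective []      e = e
  apply-injective (t ∷ r) e = swap-injective t (apply-injective r e)

module _ {n : ℕ} where

  -- y lies in the forward orbit of x under f.  IsNCycle σ says exactly that
  -- Orbit (σ ⟨$⟩ʳ_) x y holds for all points x and y.
  Orbit : (Fin n → Fin n) → Fin n → Fin n → Set
  Orbit f x y = ∃[ k ] iter k f x ≡ y

  iter-+ : ∀ (f : Fin n → Fin n) j k x → iter (j + k) f x ≡ iter j f (iter k f x)
  iter-+ f zero    k x = refl
  iter-+ f (suc j) k x = cong f (iter-+ f j k x)

  iter-suc : ∀ (f : Fin n → Fin n) k x → iter (suc k) f x ≡ iter k f (f x)
  iter-suc f zero    x = refl
  iter-suc f (suc k) x = cong f (iter-suc f k x)

  iter-injective : ∀ (f : Fin n → Fin n) → Injective _≡_ _≡_ f → ∀ k → Injective _≡_ _≡_ (iter k f)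
  iter-injective f f-inj zero    e = e
  iter-injective f f-inj (suc k) e = iter-injective f f-inj k (f-inj e)

  orbit-refl : ∀ f x → Orbit f x x
  orbit-refl f x = 0 , refl

  orbit-step : ∀ f {x y} → f x ≡ y → Orbit f x y
  orbit-step f e = 1 , e

  orbit-trans : ∀ f {x y z} → Orbit f x y → Orbit f y z → Orbit f x z
  orbit-trans f {x} (j , refl) (k , refl) = k + j , iter-+ f k j x

  orbit-cong : ∀ {f g} → (∀ z → f z ≡ g z) → ∀ {x y} → Orbit f x y → Orbit g x y
  orbit-cong {f} {g} f≗g {x} (k , e) = k , trans (sym (iterates k)) e
    where
    iterates : ∀ k → iter k f x ≡ iter k g x
    iterates zero    = refl
    iterates (suc k) = trans (f≗g _) (cong g (iterates k))

  orbit-along : ∀ {R : Fin n → Fin n → Set} {f} → (∀ {p q} → R p q → Orbit f p q)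
    → ∀ {x y} → Star R x y → Orbit f x y
  orbit-along {f = f} in-orbit ε        = orbit-refl f _
  orbit-along {f = f} in-orbit (r ◅ rs) = orbit-trans f (in-orbit r) (orbit-along in-orbit rs)

  -- An injective map of a finite set returns every point to itself
  -- (pigeonhole on x, f x, …, fⁿ x).
  periodic : ∀ (f : Fin n → Fin n) → Injective _≡_ _≡_ f → ∀ x → ∃[ p ] iter (suc p) f x ≡ x
  periodic f f-inj x with pigeonhole (n<1+n n) (λ (i : Fin (suc n)) → iter (toℕ i) f x)
  ... | i , j , i<j , same with m≤n⇒∃[o]m+o≡n i<j
  ...   | o , i+o≡j = o , iter-injective f f-inj (toℕ i) (sym (begin
      iter (toℕ i) f x                  ≡⟨ same ⟩
      iter (toℕ j) f x                  ≡⟨ cong (λ m → iter m f x) (trans (sym i+o≡j) (sym (+-suc (toℕ i) o))) ⟩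
      iter (toℕ i + suc o) f x          ≡⟨ iter-+ f (toℕ i) (suc o) x ⟩
      iter (toℕ i) f (iter (suc o) f x) ∎))
    where open ≡-Reasoning

  iter-period : ∀ (f : Fin n → Fin n) x p → iter (suc p) f x ≡ x → ∀ m → iter (m * suc p) f x ≡ x
  iter-period f x p e zero    = refl
  iter-period f x p e (suc m) =
    trans (iter-+ f (suc p) (m * suc p) x) (trans (cong (iter (suc p) f) (iter-period f x p e m)) e)

  orbit-sym : ∀ f → Injective _≡_ _≡_ f → ∀ {x y} → Orbit f x y → Orbit f y x
  orbit-sym f f-inj {x} (k , refl) with periodic f f-inj x
  ... | p , return = k * p , (begin
      iter (k * p) f (iter k f x)  ≡⟨ iter-+ f (k * p) k x ⟨
      iter (k * p + k) f x         ≡⟨ cong (λ m → iter m f x) (trans (+-comm (k * p) k) (sym (*-suc k p))) ⟩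
      iter (k * suc p) f x         ≡⟨ iter-period f x p return k ⟩
      x ∎)
    where open ≡-Reasoning

  orbit-conjugate : ∀ {σ ρ g} → Injective _≡_ _≡_ g → (∀ w → σ (g w) ≡ g (ρ w))
    → ∀ {x y} → Orbit σ (g x) (g y) → Orbit ρ x y
  orbit-conjugate {σ} {ρ} {g} g-inj commutes {x} (k , e) = k , g-inj (trans (sym (iterates k)) e)
    where
    iterates : ∀ k → iter k σ (g x) ≡ g (iter k ρ x)
    iterates zero    = refl
    iterates (suc k) = trans (cong σ (iterates k)) (commutes (iter k ρ x))

-- Composing ρ with a transposition (a b) of two points in different ρ-orbits
-- merges those two orbits and leaves every other orbit of ρ inside one orbit.
module OrbitMerge {n : ℕ} (ρ : Fin n → Fin n) (ρ-inj : Injective _≡_ _≡_ ρ)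
                  (a b : Fin n) (apart : ¬ Orbit ρ a b) where

  σ : Fin n → Fin n
  σ z = ρ (swap (a , b) z)

  σ-inj : Injective _≡_ _≡_ σ
  σ-inj e = swap-injective (a , b) (ρ-inj e)

  -- Off the ρ-orbit of a, σ agrees with ρ until the walk reaches b.
  walk-to-b : ∀ j w → ¬ Orbit ρ w a → iter j ρ w ≡ b → Orbit σ w b
  walk-to-b zero    w _     e = 0 , e
  walk-to-b (suc j) w w↛a e with w ≟ b
  ... | yes w≡b = 0 , w≡b
  ... | no  w≢b = orbit-trans σ (orbit-step σ (cong ρ (swap-fixes a b w w≢a w≢b)))
                    (walk-to-b j (ρ w) ρw↛a (trans (sym (iter-suc ρ j w)) e))
    where
    w≢a : w ≢ a
    w≢a w≡a = w↛a (0 , w≡a)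
    ρw↛a : ¬ Orbit ρ (ρ w) a
    ρw↛a (k , e′) = w↛a (suc k , trans (iter-suc ρ k w) e′)

  merged : Orbit σ a b
  merged with periodic ρ ρ-inj b
  ... | p , return = orbit-trans σ (orbit-step σ (cong ρ (swap-left a b)))
                       (walk-to-b p (ρ b) ρb↛a (trans (sym (iter-suc ρ p b)) return))
    where
    ρb↛a : ¬ Orbit ρ (ρ b) a
    ρb↛a (k , e) = apart (orbit-sym ρ ρ-inj (suc k , trans (iter-suc ρ k b) e))

  step-in-orbit : ∀ z → Orbit σ z (ρ z)
  step-in-orbit z with z ≟ a
  ... | yes refl = orbit-trans σ merged (orbit-step σ (cong ρ (swap-right a b)))
  ... | no z≢a with z ≟ b
  ...   | yes refl = orbit-trans σ (orbit-sym σ σ-inj merged) (orbit-step σ (cong ρ (swap-left a b)))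
  ...   | no z≢b   = orbit-step σ (cong ρ (swap-fixes a b z z≢a z≢b))

  refines : ∀ {x y} → Orbit ρ x y → Orbit σ x y
  refines {x} (k , refl) = along k
    where
    along : ∀ k → Orbit σ x (iter k ρ x)
    along zero    = orbit-refl σ x
    along (suc k) = orbit-trans σ (along k) (step-in-orbit (iter k ρ x))

module _ {n : ℕ} where

  Match : Term n → Fin n → Fin n → Set
  Match (a , b) x y = (a ≡ x × b ≡ y) ⊎ (a ≡ y × b ≡ x)

  Match-sym : ∀ t {x y} → Match t x y → Match t y x
  Match-sym t (inj₁ m) = inj₂ m
  Match-sym t (inj₂ m) = inj₁ m

  edgeCount : Term n → Fin n → Fin n → ℕ
  edgeCount t = mult (t ∷ [])

  edgeCount-view : ∀ t x y → (edgeCount t x y ≡ 1 × Match t x y) ⊎ (edgeCount t x y ≡ 0 × ¬ Match t x y)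
  edgeCount-view (a , b) x y with a ≟ x | b ≟ y | a ≟ y | b ≟ x
  ... | yes a≡x | yes b≡y | _       | _       = inj₁ (refl , inj₁ (a≡x , b≡y))
  ... | yes _   | no _    | yes a≡y | yes b≡x = inj₁ (refl , inj₂ (a≡y , b≡x))
  ... | yes _   | no b≢y  | yes _   | no b≢x  = inj₂ (refl , λ { (inj₁ (_ , b≡y)) → b≢y b≡y ; (inj₂ (_ , b≡x)) → b≢x b≡x })
  ... | yes _   | no b≢y  | no a≢y  | _       = inj₂ (refl , λ { (inj₁ (_ , b≡y)) → b≢y b≡y ; (inj₂ (a≡y , _)) → a≢y a≡y })
  ... | no _    | _       | yes a≡y | yes b≡x = inj₁ (refl , inj₂ (a≡y , b≡x))
  ... | no a≢x  | _       | yes _   | no b≢x  = inj₂ (refl , λ { (inj₁ (a≡x , _)) → a≢x a≡x ; (inj₂ (_ , b≡x)) → b≢x b≡x })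
  ... | no a≢x  | _       | no a≢y  | _       = inj₂ (refl , λ { (inj₁ (a≡x , _)) → a≢x a≡x ; (inj₂ (a≡y , _)) → a≢y a≡y })

  mult-∷ : ∀ t s x y → mult (t ∷ s) x y ≡ edgeCount t x y + mult s x y
  mult-∷ (a , b) s x y with a ≟ x | b ≟ y | a ≟ y | b ≟ x
  ... | yes _ | yes _ | _     | _     = refl
  ... | yes _ | no _  | yes _ | yes _ = refl
  ... | yes _ | no _  | yes _ | no _  = refl
  ... | yes _ | no _  | no _  | _     = refl
  ... | no _  | _     | yes _ | yes _ = refl
  ... | no _  | _     | yes _ | no _  = refl
  ... | no _  | _     | no _  | _     = refl

  mult-∷-match : ∀ t s {x y} → Match t x y → mult (t ∷ s) x y ≡ suc (mult s x y)
  mult-∷-match t s {x} {y} m with edgeCount-view t x y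
  ... | inj₁ (one , _) = trans (mult-∷ t s x y) (cong (_+ mult s x y) one)
  ... | inj₂ (_ , ¬m)  = ⊥-elim (¬m m)

  mult-∷-mismatch : ∀ t s {x y} → ¬ Match t x y → mult (t ∷ s) x y ≡ mult s x y
  mult-∷-mismatch t s {x} {y} ¬m with edgeCount-view t x y
  ... | inj₁ (_ , m)    = ⊥-elim (¬m m)
  ... | inj₂ (none , _) = trans (mult-∷ t s x y) (cong (_+ mult s x y) none)

  edgeCount-sym : ∀ t x y → edgeCount t x y ≡ edgeCount t y x
  edgeCount-sym t x y with edgeCount-view t x y | edgeCount-view t y x
  ... | inj₁ (e , _)  | inj₁ (e′ , _)  = trans e (sym e′)
  ... | inj₂ (e , _)  | inj₂ (e′ , _)  = trans e (sym e′)
  ... | inj₁ (_ , m)  | inj₂ (_ , ¬m′) = ⊥-elim (¬m′ (Match-sym t m))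
  ... | inj₂ (_ , ¬m) | inj₁ (_ , m′)  = ⊥-elim (¬m (Match-sym t m′))

  -- mult counts the copies of (x y) term by term; the library facts about sums
  -- then give its behaviour under concatenation, rearrangement and symmetry.
  mult-as-sum : ∀ s x y → mult s x y ≡ sum (map (λ t → edgeCount t x y) s)
  mult-as-sum []      x y = refl
  mult-as-sum (t ∷ s) x y = trans (mult-∷ t s x y) (cong (edgeCount t x y +_) (mult-as-sum s x y))

  mult-++ : ∀ xs ys x y → mult (xs ++ ys) x y ≡ mult xs x y + mult ys x y
  mult-++ xs ys x y = begin
    mult (xs ++ ys) x y                      ≡⟨ mult-as-sum (xs ++ ys) x y ⟩
    sum (map count (xs ++ ys))               ≡⟨ cong sum (map-++ count xs ys) ⟩
    sum (map count xs ++ map count ys)       ≡⟨ sum-++ (map count xs) (map count ys) ⟩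
    sum (map count xs) + sum (map count ys)  ≡⟨ cong₂ _+_ (mult-as-sum xs x y) (mult-as-sum ys x y) ⟨
    mult xs x y + mult ys x y                ∎
    where
    open ≡-Reasoning
    count : Term n → ℕ
    count t = edgeCount t x y

  mult-↭ : ∀ {r s} → r ↭ s → ∀ x y → mult r x y ≡ mult s x y
  mult-↭ {r} {s} r↭s x y = begin
    mult r x y         ≡⟨ mult-as-sum r x y ⟩
    sum (map count r)  ≡⟨ sum-↭ (map⁺ count r↭s) ⟩
    sum (map count s)  ≡⟨ mult-as-sum s x y ⟨
    mult s x y         ∎
    where
    open ≡-Reasoning
    count : Term n → ℕ
    count t = edgeCount t x y

  mult-sym : ∀ s x y → mult s x y ≡ mult s y x
  mult-sym s x y = begin
    mult s x y                           ≡⟨ mult-as-sum s x y ⟩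
    sum (map (λ t → edgeCount t x y) s)  ≡⟨ cong sum (map-cong (λ t → edgeCount-sym t x y) s) ⟩
    sum (map (λ t → edgeCount t y x) s)  ≡⟨ mult-as-sum s y x ⟨
    mult s y x                           ∎
    where open ≡-Reasoning

  mult-match : ∀ s t {x y} → Match t x y → mult s x y ≡ mult s (proj₁ t) (proj₂ t)
  mult-match s t (inj₁ (refl , refl)) = refl
  mult-match s t (inj₂ (refl , refl)) = mult-sym s _ _

  mult-pos : ∀ s x y → 0 < mult s x y → ∃[ t ] (t ∈ s × Match t x y)
  mult-pos (t ∷ s) x y pos with edgeCount-view t x y
  ... | inj₁ (_ , m)  = t , here refl , m
  ... | inj₂ (_ , ¬m) with mult-pos s x y (subst (0 <_) (mult-∷-mismatch t s ¬m) pos)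
  ...   | t′ , t′∈s , m = t′ , there t′∈s , m

module _ {n : ℕ} where
  open DecMembership (_≟_ {n}) using (_∈?_)

  record _⊑_ (s r : List (Term n)) : Set where
    constructor sub
    field bound : ∀ x y → mult s x y ≤ mult r x y
  open _⊑_

  ⊑-∷ : ∀ (t : Term n) s → s ⊑ (t ∷ s)
  ⊑-∷ t s = sub λ x y → subst (mult s x y ≤_) (sym (mult-∷ t s x y)) (m≤n+m _ _)

  ⊑-prefix : ∀ (xs ys : List (Term n)) → xs ⊑ (xs ++ ys)
  ⊑-prefix xs ys = sub λ x y → subst (mult xs x y ≤_) (sym (mult-++ xs ys x y)) (m≤m+n _ _)

  ↭⇒⊑ : ∀ {r s} → r ↭ s → r ⊑ s
  ↭⇒⊑ r↭s = sub λ x y → ≤-reflexive (mult-↭ r↭s x y)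

  mult-∈ : ∀ {s} t → t ∈ s → 1 ≤ mult s (proj₁ t) (proj₂ t)
  mult-∈ {t′ ∷ s} t (here refl) = subst (1 ≤_) (sym (mult-∷-match t s (inj₁ (refl , refl)))) (s≤s z≤n)
  mult-∈ {t′ ∷ s} t (there t∈s) = ≤-trans (mult-∈ t t∈s) (bound (⊑-∷ t′ s) _ _)

  adj-mono : ∀ {s r} → s ⊑ r → ∀ {x y} → Adj s x y → Adj r x y
  adj-mono s⊑r {x} {y} (x≢y , pos) = x≢y , <-≤-trans pos (bound s⊑r x y)

  path-mono : ∀ {s r} → s ⊑ r → ∀ {x y} → Star (Adj s) x y → Star (Adj r) x y
  path-mono s⊑r = Star.map (adj-mono s⊑r)

  walk-mono : ∀ {s r} → s ⊑ r → ∀ {vs} → Walk s vs → Walk r vs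
  walk-mono s⊑r (single v)             = single v
  walk-mono s⊑r (step v w vs v~w rest) = step v w vs (adj-mono s⊑r v~w) (walk-mono s⊑r rest)

  cycle-mono : ∀ {s r} → s ⊑ r → HasCycle s → HasCycle r
  cycle-mono s⊑r (v , vs , walk , unique , long , closing) =
    v , vs , walk-mono s⊑r walk , unique , long , adj-mono s⊑r closing

  adj-sym : ∀ (s : List (Term n)) {x y} → Adj s x y → Adj s y x
  adj-sym s {x} {y} (x≢y , pos) = (λ y≡x → x≢y (sym y≡x)) , subst (0 <_) (mult-sym s x y) pos

  adj-head : ∀ (a b : Fin n) s {x y} → a ≢ b → Match (a , b) x y → Adj ((a , b) ∷ s) x y
  adj-head a b s a≢b m = distinct m , subst (0 <_) (sym (mult-∷-match _ s m)) (s≤s z≤n)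
    where
    distinct : ∀ {x y} → Match _ x y → x ≢ y
    distinct (inj₁ (refl , refl)) = a≢b
    distinct (inj₂ (refl , refl)) = λ b≡a → a≢b (sym b≡a)

  adj-∷ : ∀ (t : Term n) s {x y} → Adj (t ∷ s) x y → Match t x y ⊎ Adj s x y
  adj-∷ t s {x} {y} (x≢y , pos) with edgeCount-view t x y
  ... | inj₁ (_ , m)  = inj₁ m
  ... | inj₂ (_ , ¬m) = inj₂ (x≢y , subst (0 <_) (mult-∷-mismatch t s ¬m) pos)

  path-to-image : ∀ (s : List (Term n)) → IsTranspositional s → ∀ z → Star (Adj s) z (apply s z)
  path-to-image []            []         z = ε
  path-to-image ((a , b) ∷ s) (a≢b ∷ tr) z =
    first-step (z ≟ a) (z ≟ b) ◅◅ path-mono (⊑-∷ (a , b) s) (path-to-image s tr (swap (a , b) z))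
    where
    first-step : Dec (z ≡ a) → Dec (z ≡ b) → Star (Adj ((a , b) ∷ s)) z (swap (a , b) z)
    first-step (yes refl) _          =
      subst (Star _ z) (sym (swap-left z b)) (adj-head z b s a≢b (inj₁ (refl , refl)) ◅ ε)
    first-step (no _)     (yes refl) =
      subst (Star _ z) (sym (swap-right a z)) (adj-head a z s a≢b (inj₂ (refl , refl)) ◅ ε)
    first-step (no z≢a)   (no z≢b)   = subst (Star _ z) (sym (swap-fixes a b z z≢a z≢b)) ε

  orbit⇒path : ∀ (s : List (Term n)) → IsTranspositional s → ∀ {x y} → Orbit (apply s) x y → Star (Adj s) x y
  orbit⇒path s tr {x} (k , refl) = along k
    where
    along : ∀ k → Star (Adj s) x (iter k (apply s) x)
    along zero    = ε
    along (suc k) = along k ◅◅ path-to-image s tr (iter k (apply s) x)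

  record SimplePath (s : List (Term n)) (x y : Fin n) : Set where
    constructor simple
    field
      vertices : List (Fin n)
      walk     : Walk s (x ∷ vertices)
      unique   : Unique (x ∷ vertices)
      ends     : last x vertices ≡ y

  suffix-from : ∀ {s x z vs} → x ∈ (z ∷ vs) → Walk s (z ∷ vs) → Unique (z ∷ vs)
    → Σ[ ws ∈ List (Fin n) ] (Walk s (x ∷ ws) × Unique (x ∷ ws) × last x ws ≡ last z vs)
  suffix-from {vs = vs}     (here refl)  walk                 unique       = vs , walk , unique , refl
  suffix-from {vs = v ∷ vs} (there x∈vs) (step _ _ _ _ walk) (_ ∷ unique) = suffix-from x∈vs walk unique

  -- Prepending an edge to a simple path; if the new vertex already occurs,
  -- the path is shortcut there instead.
  prepend : ∀ {s x z y} → Adj s x z → SimplePath s z y → SimplePath s x y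
  prepend {x = x} {z} x~z (simple vs walk unique ends) with x ∈? (z ∷ vs)
  ... | no x∉  = simple (z ∷ vs) (step x z vs x~z walk) (¬Any⇒All¬ (z ∷ vs) x∉ ∷ unique) ends
  ... | yes x∈ with suffix-from x∈ walk unique
  ...   | ws , walk′ , unique′ , ends′ = simple ws walk′ unique′ (trans ends′ ends)

  simple-path : ∀ {s x y} → Star (Adj s) x y → SimplePath s x y
  simple-path {x = x} ε = simple [] (single x) ([] ∷ []) refl
  simple-path (x~z ◅ rest) = prepend x~z (simple-path rest)

  closing-cycle : ∀ {s r a b} → s ⊑ r → mult s a b ≡ 0 → a ≢ b → Adj r b a
    → Star (Adj s) a b → HasCycle r
  closing-cycle {r = r} {a = a} s⊑r no-ab a≢b b~a path with simple-path path
  ... | simple []           _                               _ ends = ⊥-elim (a≢b ends)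
  ... | simple (v ∷ [])     (step _ _ _ (_ , pos) _)        _ refl = ⊥-elim (<-irrefl (sym no-ab) pos)
  ... | simple (v ∷ w ∷ vs) walk unique ends =
    a , v ∷ w ∷ vs , walk-mono s⊑r walk , unique , s≤s (s≤s z≤n) , subst (λ c → Adj r c a) (sym ends) b~a

module _ {n : ℕ} where
  open _⊑_

  OddMultiplicities : List (Term n) → Set
  OddMultiplicities r = ∀ (x y : Fin n) → x ≢ y → 0 < mult r x y → mult r x y % 2 ≡ 1

  NonSimpleMatching : List (Term n) → Set
  NonSimpleMatching r =
    ∀ (v x y : Fin n) → v ≢ x → v ≢ y → 2 ≤ mult r v x → 2 ≤ mult r v y → x ≡ y

  record Admissible (r : List (Term n)) : Set where
    field
      transpositional : IsTranspositional r
      acyclic         : ¬ HasCycle r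
      odd             : OddMultiplicities r
      matching        : NonSimpleMatching r

  record _⊆ₑ_ (s r : List (Term n)) : Set where
    constructor deleting
    field kept-or-deleted : ∀ x y → mult s x y ≡ 0 ⊎ mult s x y ≡ mult r x y
  open _⊆ₑ_

  ⊆ₑ⇒⊑ : ∀ {s r} → s ⊆ₑ r → s ⊑ r
  ⊆ₑ⇒⊑ s⊆r = sub λ x y → bounded (kept-or-deleted s⊆r x y)
    where
    bounded : ∀ {m k} → m ≡ 0 ⊎ m ≡ k → m ≤ k
    bounded (inj₁ refl) = z≤n
    bounded (inj₂ refl) = ≤-refl

  admissible-⊆ₑ : ∀ {s r} → IsTranspositional s → s ⊆ₑ r → Admissible r → Admissible s
  admissible-⊆ₑ {s} tr s⊆r adm = record
    { transpositional = tr
    ; acyclic         = λ cycle → acyclic (cycle-mono (⊆ₑ⇒⊑ s⊆r) cycle)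
    ; odd             = odd′
    ; matching        = λ v x y v≢x v≢y vx vy →
        matching v x y v≢x v≢y (≤-trans vx (bound (⊆ₑ⇒⊑ s⊆r) v x)) (≤-trans vy (bound (⊆ₑ⇒⊑ s⊆r) v y))
    }
    where
    open Admissible adm
    odd′ : OddMultiplicities s
    odd′ x y x≢y pos with kept-or-deleted s⊆r x y
    ... | inj₁ none = ⊥-elim (<-irrefl (sym none) pos)
    ... | inj₂ kept = subst (λ m → m % 2 ≡ 1) (sym kept) (odd x y x≢y (subst (0 <_) kept pos))

  admissible-↭ : ∀ {r s} → r ↭ s → Admissible r → Admissible s
  admissible-↭ r↭s adm = admissible-⊆ₑ (All-resp-↭ r↭s (Admissible.transpositional adm))
    (deleting λ x y → inj₂ (sym (mult-↭ r↭s x y))) adm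

  simple-head : ∀ (t : Term n) s → mult (t ∷ s) (proj₁ t) (proj₂ t) ≡ 1 → mult s (proj₁ t) (proj₂ t) ≡ 0
  simple-head t s one = cong pred (trans (sym (mult-∷-match t s {proj₁ t} {proj₂ t} (inj₁ (refl , refl)))) one)

  admissible-tail : ∀ (t : Term n) s → mult (t ∷ s) (proj₁ t) (proj₂ t) ≡ 1 → Admissible (t ∷ s) → Admissible s
  admissible-tail t s one adm =
    admissible-⊆ₑ (tail (Admissible.transpositional adm)) (deleting kept-or-deleted′) adm
    where
    kept-or-deleted′ : ∀ x y → mult s x y ≡ 0 ⊎ mult s x y ≡ mult (t ∷ s) x y
    kept-or-deleted′ x y with edgeCount-view t x y
    ... | inj₁ (_ , m)  = inj₁ (trans (mult-match s t m) (simple-head t s one))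
    ... | inj₂ (_ , ¬m) = inj₂ (sym (mult-∷-mismatch t s ¬m))

  Endpoint : Fin n → Fin n → Fin n → Set
  Endpoint p q z = z ≡ p ⊎ z ≡ q

  Touches : Term n → Fin n → Fin n → Set
  Touches (c , d) p q = Endpoint p q c ⊎ Endpoint p q d

  IsolatedEdge : Fin n → Fin n → Term n → Set
  IsolatedEdge p q t = Touches t p q → Match t p q

  swap-match : ∀ t {p q z} → Match t p q → Endpoint p q z → swap t z ≡ swap (p , q) z
  swap-match t (inj₁ (refl , refl)) _          = refl
  swap-match t {p} {q} (inj₂ (refl , refl)) (inj₁ refl) = trans (swap-right q p) (sym (swap-left p q))
  swap-match t {p} {q} (inj₂ (refl , refl)) (inj₂ refl) = trans (swap-left q p) (sym (swap-right p q))

  swap-untouched : ∀ t {p q z} → ¬ Touches t p q → Endpoint p q z → swap t z ≡ z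
  swap-untouched (c , d) {p} {q} {z} ¬touch end =
    swap-fixes c d z (λ z≡c → ¬touch (inj₁ (subst (Endpoint p q) z≡c end)))
                     (λ z≡d → ¬touch (inj₂ (subst (Endpoint p q) z≡d end)))

  swap-endpoint : ∀ {p q z} → Endpoint p q z → Endpoint p q (swap (p , q) z)
  swap-endpoint {p} {q} (inj₁ refl) = inj₂ (swap-left p q)
  swap-endpoint {p} {q} (inj₂ refl) = inj₁ (swap-right p q)

  apply-isolated : ∀ s {p q} → All (IsolatedEdge p q) s
    → ∀ {z} → Endpoint p q z → apply s z ≡ iter (mult s p q) (swap (p , q)) z
  apply-isolated []      _                 _   = refl
  apply-isolated (t ∷ s) {p} {q} (iso ∷ isos) {z} end with edgeCount-view t p q
  ... | inj₁ (_ , m) = begin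
    apply s (swap t z)                          ≡⟨ cong (apply s) (swap-match t m end) ⟩
    apply s (swap (p , q) z)                    ≡⟨ apply-isolated s isos (swap-endpoint end) ⟩
    iter (mult s p q) (swap (p , q)) (swap (p , q) z) ≡⟨ iter-suc (swap (p , q)) (mult s p q) z ⟨
    iter (suc (mult s p q)) (swap (p , q)) z    ≡⟨ cong (λ k → iter k (swap (p , q)) z) (mult-∷-match t s m) ⟨
    iter (mult (t ∷ s) p q) (swap (p , q)) z    ∎
    where open ≡-Reasoning
  ... | inj₂ (_ , ¬m) = begin
    apply s (swap t z)                          ≡⟨ cong (apply s) (swap-untouched t (λ touch → ¬m (iso touch)) end) ⟩
    apply s z                                   ≡⟨ apply-isolated s isos end ⟩
    iter (mult s p q) (swap (p , q)) z          ≡⟨ cong (λ k → iter k (swap (p , q)) z) (mult-∷-mismatch t s ¬m) ⟨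
    iter (mult (t ∷ s) p q) (swap (p , q)) z    ∎
    where open ≡-Reasoning

  iter-odd-swap : ∀ (p q : Fin n) m → m % 2 ≡ 1 → iter m (swap (p , q)) p ≡ q
  iter-odd-swap p q (suc zero)    _   = swap-left p q
  iter-odd-swap p q (suc (suc m)) odd =
    trans (swap-involutive (p , q) (iter m (swap (p , q)) p)) (iter-odd-swap p q m odd)

  touching-is-copy : ∀ {r} → NonSimpleMatching r → ∀ {c d p q} → c ≢ d → p ≢ q
    → 2 ≤ mult r c d → 2 ≤ mult r p q → Touches (c , d) p q → Match (c , d) p q
  touching-is-copy {r} matching {c} {d} {p} {q} c≢d p≢q cd pq touch = by-case touch
    where
    d≢c : d ≢ c
    d≢c d≡c = c≢d (sym d≡c)
    q≢p : q ≢ p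
    q≢p q≡p = p≢q (sym q≡p)
    dc : 2 ≤ mult r d c
    dc = subst (2 ≤_) (mult-sym r c d) cd
    qp : 2 ≤ mult r q p
    qp = subst (2 ≤_) (mult-sym r p q) pq
    by-case : Touches (c , d) p q → Match (c , d) p q
    by-case (inj₁ (inj₁ refl)) = inj₁ (refl , matching c d q c≢d p≢q cd pq)
    by-case (inj₁ (inj₂ refl)) = inj₂ (refl , matching c d p c≢d q≢p cd qp)
    by-case (inj₂ (inj₁ refl)) = inj₂ (matching d c q d≢c p≢q dc pq , refl)
    by-case (inj₂ (inj₂ refl)) = inj₁ (matching d c p d≢c q≢p dc qp , refl)

  NonSimple : List (Term n) → Set
  NonSimple r = All (λ t → mult r (proj₁ t) (proj₂ t) ≢ 1) r

  nonsimple-mult : ∀ {r} → NonSimple r → ∀ {t} → t ∈ r → 2 ≤ mult r (proj₁ t) (proj₂ t)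
  nonsimple-mult {r} nonsimple {t} t∈r with mult r (proj₁ t) (proj₂ t) | mult-∈ t t∈r | lookup nonsimple t∈r
  ... | suc zero    | _ | ≢1 = ⊥-elim (≢1 refl)
  ... | suc (suc _) | _ | _  = s≤s (s≤s z≤n)

  apply-nonsimple-edge : ∀ {r} → Admissible r → NonSimple r → ∀ {p q} → Adj r p q → apply r p ≡ q
  apply-nonsimple-edge {r} adm nonsimple {p} {q} (p≢q , pos) with mult-pos r p q pos
  ... | t , t∈r , t~pq = trans (apply-isolated r (tabulate isolated) (inj₁ refl))
                               (iter-odd-swap p q (mult r p q) (odd p q p≢q pos))
    where
    open Admissible adm
    pq : 2 ≤ mult r p q
    pq = subst (2 ≤_) (sym (mult-match r t t~pq)) (nonsimple-mult nonsimple t∈r)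
    isolated : ∀ {t′} → t′ ∈ r → IsolatedEdge p q t′
    isolated {c , d} t′∈r = touching-is-copy {r} matching (lookup transpositional t′∈r) p≢q
                              (nonsimple-mult nonsimple t′∈r) pq

  EdgesInOrbits : List (Term n) → Set
  EdgesInOrbits r = ∀ {x y} → Adj r x y → Orbit (apply r) x y

  -- (★) is invariant under rotation: apply (ys ++ xs) is conjugate to
  -- apply (xs ++ ys) by apply xs, which moves points within components of 𝒯.
  rotate : ∀ xs ys → IsTranspositional xs → EdgesInOrbits (ys ++ xs) → EdgesInOrbits (xs ++ ys)
  rotate xs ys tr rotated-in-orbits {x} {y} x~y =
    orbit-conjugate (apply-injective xs) (apply-rotate xs ys)
      (orbit-along (λ e → rotated-in-orbits (adj-mono (↭⇒⊑ (++-comm xs ys)) e))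
        (Star.reverse (adj-sym (xs ++ ys)) (to-image x) ◅◅ x~y ◅ to-image y))
    where
    to-image : ∀ z → Star (Adj (xs ++ ys)) z (apply xs z)
    to-image z = path-mono (⊑-prefix xs ys) (path-to-image xs tr z)

  -- Adding a simple edge a — b in front of s: a and b lie in different orbits
  -- of apply s (else 𝒯 would contain a cycle), so composing with (a b) merges them.
  insert-simple : ∀ a b s → IsTranspositional ((a , b) ∷ s) → ¬ HasCycle ((a , b) ∷ s)
    → mult s a b ≡ 0 → EdgesInOrbits s → EdgesInOrbits ((a , b) ∷ s)
  insert-simple a b s (a≢b ∷ tr) acyclic no-ab in-orbits = in-merged-orbits
    where
    apart : ¬ Orbit (apply s) a b
    apart o = acyclic (closing-cycle (⊑-∷ (a , b) s) no-ab a≢b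
      (adj-head a b s a≢b (inj₂ (refl , refl))) (orbit⇒path s tr o))

    open OrbitMerge (apply s) (apply-injective s) a b apart

    in-merged-orbits : EdgesInOrbits ((a , b) ∷ s)
    in-merged-orbits x~y with adj-∷ (a , b) s x~y
    ... | inj₁ (inj₁ (refl , refl)) = merged
    ... | inj₁ (inj₂ (refl , refl)) = orbit-sym σ σ-inj merged
    ... | inj₂ x~ₛy                 = refines (in-orbits x~ₛy)

  simple-term? : ∀ r → (∃[ xs ] ∃[ t ] ∃[ ys ] (r ≡ xs ++ t ∷ ys × mult r (proj₁ t) (proj₂ t) ≡ 1))
                       ⊎ NonSimple r
  simple-term? r with any? (λ t → mult r (proj₁ t) (proj₂ t) ℕ.≟ 1) r
  ... | no none  = inj₂ (¬Any⇒All¬ r none)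
  ... | yes some with find some
  ...   | t , t∈r , t-simple with ∈-∃++ t∈r
  ...     | xs , ys , r≡ = inj₁ (xs , t , ys , r≡ , t-simple)

  edges-in-orbits : ∀ m r → length r ≤ m → Admissible r → EdgesInOrbits r
  edges-in-orbits zero    []    _   _   (_ , ())
  edges-in-orbits (suc m) r     len adm with simple-term? r
  ... | inj₂ nonsimple = λ e → orbit-step (apply r) (apply-nonsimple-edge adm nonsimple e)
  ... | inj₁ (xs , (a , b) , ys , refl , t-simple) =
    rotate xs ((a , b) ∷ ys) (++⁻ˡ xs (Admissible.transpositional adm))
      (insert-simple a b s (Admissible.transpositional adm′) (Admissible.acyclic adm′)
        (simple-head (a , b) s simple′) shorter-in-orbits)
    where
    s = ys ++ xs
    rotation : xs ++ (a , b) ∷ ys ↭ (a , b) ∷ s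
    rotation = ++-comm xs ((a , b) ∷ ys)
    adm′ : Admissible ((a , b) ∷ s)
    adm′ = admissible-↭ rotation adm
    simple′ : mult ((a , b) ∷ s) a b ≡ 1
    simple′ = trans (sym (mult-↭ rotation a b)) t-simple
    shorter-in-orbits : EdgesInOrbits s
    shorter-in-orbits = edges-in-orbits m s (≤-pred (subst (_≤ suc m) (↭-length rotation) len))
                          (admissible-tail (a , b) s simple′ adm′)

theorem3p4 : ∀ (n : ℕ) → 2 ≤ n → (u : List (Term n)) → IsTranspositional u
    → IsMultitree u
    → (∀ (x y : Fin n) → x ≢ y → 0 < mult u x y → mult u x y % 2 ≡ 1)
    → (∀ (v x y : Fin n) → v ≢ x → v ≢ y → 2 ≤ mult u v x → 2 ≤ mult u v y → x ≡ y)
    → ∀ (r : List (Term n)) → r ↭ u → IsNCycle (○ r)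
theorem3p4 n _ u tr (connected , acyclic) odd matching r r↭u x y =
  orbit-cong (λ z → sym (○-apply r z))
    (orbit-along (edges-in-orbits (length r) r ≤-refl admissible-r)
      (path-mono (↭⇒⊑ (↭-sym r↭u)) (connected x y)))
  where
  admissible-r : Admissible r
  admissible-r = admissible-↭ (↭-sym r↭u) record
    { transpositional = tr ; acyclic = acyclic ; odd = odd ; matching = matching }
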